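{- For $n\ge2$ let $H_n(x_1,\dots,x_n)=\bigvee_{1\le i<j\le n}x_i\wedge x_j$. Then $(H_n)_{n\ge2}$ is an infinite antichain with respect to $\preceq_{\bf V}$. Furthermore, for each $n\ge2$, the family $(G^n_m)_{m\ge n}$ defined by $G^n_m(x_1,\dots,x_{m+n-1})=H_n(x_1,\dots,x_{n-1},H_m(x_n,\dots,x_{m+n-1}))$ is also an infinite antichain with respect to $\preceq_{\bf V}$.
   Context: For an $m$-ary Boolean function $g$ and an $n$-ary Boolean function $f$, $g\preceq_{\bf V}f$ means $g=f(p_1,\dots,p_n)$ for some $m$-ary projections $p_1,\dots,p_n$. An antichain is a set of functions pairwise incomparable under $\preceq_{\bf V}$. -}

module Defs where

open import Data.Bool using (Bool; true; false; _∧_; _∨_)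
open import Data.Nat using (ℕ; zero; suc; _+_; _∸_; _<ᵇ_)
open import Data.Fin using (Fin; toℕ; _↑ˡ_; _↑ʳ_)
open import Data.Product using (Σ)
open import Data.Vec.Functional using (_++_)
open import Function using (_∘_)
open import Relation.Binary.PropositionalEquality using (_≡_)

BFun : ℕ → Set
BFun n = (Fin n → Bool) → Bool

-- g ⪯V f : g = f(p_1,…,p_n) for some m-ary projections p_i,
-- i.e. p_i(x) = x_{σ(i)} for a map σ : Fin n → Fin m (equality pointwise).
_⪯V_ : {m n : ℕ} → BFun m → BFun n → Set
_⪯V_ {m} {n} g f = Σ (Fin n → Fin m) λ σ → (x : Fin m → Bool) → g x ≡ f (x ∘ σ)

⋁ : (n : ℕ) → (Fin n → Bool) → Bool
⋁ zero    f = false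
⋁ (suc n) f = f Fin.zero ∨ ⋁ n (f ∘ Fin.suc)

H : (n : ℕ) → BFun n
H n x = ⋁ n (λ i → ⋁ n (λ j → (toℕ i <ᵇ toℕ j) ∧ (x i ∧ x j)))

-- G^n_m(x_1,…,x_{m+n-1}) = H_n(x_1,…,x_{n-1}, H_m(x_n,…,x_{m+n-1})),
-- arity written as (n ∸ 1) + m; H_n is applied at arity (n ∸ 1) + 1 (= n for n ≥ 1).
G : (n m : ℕ) → BFun ((n ∸ 1) + m)
G n m x = H ((n ∸ 1) + 1)
            ((λ i → x (i ↑ˡ m)) ++ (λ _ → H m (λ j → x ((n ∸ 1) ↑ʳ j))))

-- H n x holds iff at least two coordinates of x hold, and G n m is G′ a m with a = n ∸ 1 left
-- and m right variables, which holds iff two left variables hold, or one left and two right ones.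
-- Suppose g x = f (x ∘ σ) for two members g, f of one family. Every variable of g is essential,
-- so σ is onto and g has at most as many variables as f. For H, σ is also injective: if σ i = σ j with
-- i ≢ j, the one-point input ⁅ σ i ⁆ is false for H n but pulls back to two true coordinates.
-- For G, if m < m′, pigeonhole produces right variables j ≢ j′ and a left variable p of G′ a m′
-- whose images all lie in a false point of G′ a m (the whole right block, or one variable with
-- one right variable), while its pull-back is true. The classes fed to the pigeonhole depend on
-- whether some left variable of G′ a m′ is sent into the right block.
module Submission where

open import Defs
open import Data.Bool using (Bool; false; T; _∧_; _∨_)
open import Data.Bool.Properties using (T-∧; T-∨; ∨-identityʳ)
open import Data.Nat using (ℕ; zero; suc; _+_; _<ᵇ_; _≤_; _<_; z≤n; s≤s)
open import Data.Nat.Properties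
  using (<ᵇ⇒<; <⇒<ᵇ; <-cmp; <-irrefl; ≤-antisym; ≮⇒≥; <⇒≤; ≤-<-trans; +-cancelˡ-≤)
open import Data.Fin using (Fin; zero; suc; toℕ; _↑ˡ_; _↑ʳ_; _≟_; punchIn; inject≤; fromℕ<)
open import Data.Fin.Properties
  using (toℕ-injective; suc-injective; ↑ˡ-injective; ↑ʳ-injective; inject≤-injective;
         punchInᵢ≢i; <⇒≢; any?; pigeonhole; injective⇒≤)
open import Data.Product using (∃; ∃₂; _×_; _,_; proj₁; proj₂)
open import Data.Sum using (_⊎_; inj₁; inj₂; [_,_]; [_,_]′)
open import Data.Vec.Functional using (_++_)
open import Data.Vec.Functional.Properties using (lookup-++ˡ; lookup-++ʳ; ++-cong)
open import Function using (_∘_; Injective; Equivalence)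
open import Relation.Binary.Definitions using (tri<; tri≈; tri>)
open import Relation.Binary.PropositionalEquality
  using (_≡_; _≢_; _≗_; refl; sym; trans; cong; cong₂; subst)
open import Relation.Nullary using (¬_; Dec; yes; no; contradiction)
open import Relation.Nullary.Decidable using (isYes; isYes≗does; toWitness; fromWitness; dec-false)

open Equivalence using (to; from)

private
  variable
    n n′ : ℕ

⋁-intro : ∀ n (f : Fin n → Bool) i → T (f i) → T (⋁ n f)
⋁-intro (suc n) f zero    fi = from T-∨ (inj₁ fi)
⋁-intro (suc n) f (suc i) fi = from T-∨ (inj₂ (⋁-intro n (f ∘ suc) i fi))

⋁-elim : ∀ n (f : Fin n → Bool) → T (⋁ n f) → ∃ λ i → T (f i)
⋁-elim (suc n) f t with to T-∨ t
... | inj₁ f₀ = zero , f₀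
... | inj₂ fₛ with ⋁-elim n (f ∘ suc) fₛ
...   | i , fᵢ = suc i , fᵢ

⋁-cong : ∀ n {f g : Fin n → Bool} → f ≗ g → ⋁ n f ≡ ⋁ n g
⋁-cong zero    f≗g = refl
⋁-cong (suc n) f≗g = cong₂ _∨_ (f≗g zero) (⋁-cong n (f≗g ∘ suc))

Extensional : BFun n → Set
Extensional f = ∀ {x y} → x ≗ y → f x ≡ f y

H-cong : ∀ n → Extensional (H n)
H-cong n x≗y = ⋁-cong n λ i → ⋁-cong n λ j →
  cong₂ (λ u v → (toℕ i <ᵇ toℕ j) ∧ (u ∧ v)) (x≗y i) (x≗y j)

H-intro-< : ∀ n (x : Fin n → Bool) {i j} → toℕ i < toℕ j → T (x i) → T (x j) → T (H n x)
H-intro-< n x {i} {j} i<j xᵢ xⱼ =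
  ⋁-intro n _ i (⋁-intro n _ j (from T-∧ (<⇒<ᵇ i<j , from T-∧ (xᵢ , xⱼ))))

H-intro : ∀ n (x : Fin n → Bool) {i j} → i ≢ j → T (x i) → T (x j) → T (H n x)
H-intro n x {i} {j} i≢j xᵢ xⱼ with <-cmp (toℕ i) (toℕ j)
... | tri< i<j _ _ = H-intro-< n x i<j xᵢ xⱼ
... | tri≈ _ i≡j _ = contradiction (toℕ-injective i≡j) i≢j
... | tri> _ _ j<i = H-intro-< n x j<i xⱼ xᵢ

H-elim : ∀ n (x : Fin n → Bool) → T (H n x) → ∃₂ λ i j → i ≢ j × T (x i) × T (x j)
H-elim n x h with ⋁-elim n _ h
... | i , hᵢ with ⋁-elim n _ hᵢ
...   | j , hᵢⱼ with to (T-∧ {toℕ i <ᵇ toℕ j}) hᵢⱼ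
...     | i<j , xᵢⱼ = i , j , i≢j , to (T-∧ {x i}) xᵢⱼ
  where
  i≢j : i ≢ j
  i≢j refl = <-irrefl refl (<ᵇ⇒< (toℕ i) (toℕ i) i<j)

H-atMostOne : ∀ n (x : Fin n → Bool) → (∀ {i j} → T (x i) → T (x j) → i ≡ j) → ¬ T (H n x)
H-atMostOne n x unique h with H-elim n x h
... | i , j , i≢j , xᵢ , xⱼ = i≢j (unique xᵢ xⱼ)

⁅_⁆ : Fin n → Fin n → Bool
⁅ u ⁆ t = isYes (t ≟ u)

_∪_ : (x y : Fin n → Bool) → Fin n → Bool
(x ∪ y) t = x t ∨ y t

⁅⁆-intro : ∀ {u t : Fin n} → t ≡ u → T (⁅ u ⁆ t)
⁅⁆-intro {u = u} {t} = fromWitness {a? = t ≟ u}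

⁅⁆-self : ∀ (u : Fin n) → T (⁅ u ⁆ u)
⁅⁆-self u = ⁅⁆-intro {u = u} refl

⁅⁆-elim : ∀ {u t : Fin n} → T (⁅ u ⁆ t) → t ≡ u
⁅⁆-elim {u = u} {t} = toWitness {a? = t ≟ u}

⁅⁆-miss : ∀ {u t : Fin n} → t ≢ u → ⁅ u ⁆ t ≡ false
⁅⁆-miss {u = u} {t} t≢u = trans (isYes≗does (t ≟ u)) (dec-false (t ≟ u) t≢u)

∪-elim : ∀ (x y : Fin n → Bool) t → T ((x ∪ y) t) → T (x t) ⊎ T (y t)
∪-elim x y t = to T-∨

∪-introˡ : ∀ (x y : Fin n → Bool) t → T (x t) → T ((x ∪ y) t)
∪-introˡ x y t xₜ = from T-∨ (inj₁ xₜ)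

∪-introʳ : ∀ (x y : Fin n → Bool) t → T (y t) → T ((x ∪ y) t)
∪-introʳ x y t yₜ = from T-∨ (inj₂ yₜ)

H-⁅⁆ : ∀ n (u : Fin n) → ¬ T (H n ⁅ u ⁆)
H-⁅⁆ n u = H-atMostOne n ⁅ u ⁆ λ i≡u j≡u → trans (⁅⁆-elim i≡u) (sym (⁅⁆-elim j≡u))

-- The monotone half of "v is an essential variable of g".
Essential : BFun n → Fin n → Set
Essential g v = ∃ λ x → ¬ T (g x) × T (g (x ∪ ⁅ v ⁆))

⪯V-reflects-T : ∀ {g : BFun n} {f : BFun n′} ((σ , _) : g ⪯V f) x → T (f (x ∘ σ)) → T (g x)
⪯V-reflects-T (σ , g≡f∘σ) x = subst T (sym (g≡f∘σ x))

essential-∈-image : ∀ {g : BFun n} {f : BFun n′} → Extensional f →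
                    ((σ , _) : g ⪯V f) → ∀ {v} → Essential g v → ∃ λ j → σ j ≡ v
essential-∈-image {g = g} f-ext (σ , g≡f∘σ) {v} (x , ¬gx , gx∪v) with any? (λ j → σ j ≟ v)
... | yes hit = hit
... | no miss = contradiction (subst T same gx∪v) ¬gx
  where
  unchanged : (x ∪ ⁅ v ⁆) ∘ σ ≗ x ∘ σ
  unchanged j = trans (cong (x (σ j) ∨_) (⁅⁆-miss (miss ∘ (j ,_)))) (∨-identityʳ _)
  same : g (x ∪ ⁅ v ⁆) ≡ g x
  same = trans (g≡f∘σ _) (trans (f-ext unchanged) (sym (g≡f∘σ x)))

essential⇒≤ : ∀ {g : BFun n} {f : BFun n′} → Extensional f → g ⪯V f → (∀ v → Essential g v) → n ≤ n′
essential⇒≤ f-ext g≤f ess = injective⇒≤ {f = λ v → proj₁ (hit v)} λ {v} {w} e →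
  trans (sym (proj₂ (hit v))) (trans (cong (proj₁ g≤f) e) (proj₂ (hit w)))
  where
  hit : ∀ v → ∃ λ j → proj₁ g≤f j ≡ v
  hit v = essential-∈-image f-ext g≤f (ess v)

twoPoints : 2 ≤ n → ∃₂ λ (q q′ : Fin n) → q ≢ q′
twoPoints (s≤s (s≤s z≤n)) = zero , suc zero , λ ()

another : 2 ≤ n → (j : Fin n) → ∃ λ j′ → j′ ≢ j
another (s≤s (s≤s z≤n)) j = punchIn j zero , punchInᵢ≢i j zero

H-essential : 2 ≤ n → ∀ v → Essential (H n) v
H-essential {n} 2≤n v = ⁅ w ⁆ , H-⁅⁆ n w ,
  H-intro n (⁅ w ⁆ ∪ ⁅ v ⁆) w≢v (∪-introˡ ⁅ w ⁆ ⁅ v ⁆ w (⁅⁆-self w)) (∪-introʳ ⁅ w ⁆ ⁅ v ⁆ v (⁅⁆-self v))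
  where
  w : Fin n
  w = proj₁ (another 2≤n v)
  w≢v : w ≢ v
  w≢v = proj₂ (another 2≤n v)

H-⪯V-injective : ((σ , _) : H n ⪯V H n′) → Injective _≡_ _≡_ σ
H-⪯V-injective {n} {n′} H≤H′@(σ , _) {i} {j} σi≡σj with i ≟ j
... | yes i≡j = i≡j
... | no  i≢j = contradiction (⪯V-reflects-T {g = H n} {f = H n′} H≤H′ ⁅ σ i ⁆ pulledBackTwice) (H-⁅⁆ n (σ i))
  where
  pulledBackTwice : T (H n′ (⁅ σ i ⁆ ∘ σ))
  pulledBackTwice = H-intro n′ (⁅ σ i ⁆ ∘ σ) i≢j (⁅⁆-self (σ i)) (⁅⁆-intro (sym σi≡σj))

H-⪯V⇒≡ : 2 ≤ n → H n ⪯V H n′ → n ≡ n′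
H-⪯V⇒≡ {n′ = n′} 2≤n H≤H′ =
  ≤-antisym (essential⇒≤ (H-cong n′) H≤H′ (H-essential 2≤n)) (injective⇒≤ (H-⪯V-injective H≤H′))

G′ : (a m : ℕ) → BFun (a + m)
G′ a m x = H (a + 1) ((x ∘ (_↑ˡ m)) ++ λ _ → H m (x ∘ (a ↑ʳ_)))

data Split (a m : ℕ) : Fin (a + m) → Set where
  left  : (i : Fin a) → Split a m (i ↑ˡ m)
  right : (j : Fin m) → Split a m (a ↑ʳ j)

split : ∀ a m (v : Fin (a + m)) → Split a m v
split zero    m v       = right v
split (suc a) m zero    = left zero
split (suc a) m (suc v) with split a m v
... | left i  = left (suc i)
... | right j = right j

↑ˡ≢↑ʳ : ∀ {a m} (i : Fin a) (j : Fin m) → i ↑ˡ m ≢ a ↑ʳ j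
↑ˡ≢↑ʳ zero    j ()
↑ˡ≢↑ʳ (suc i) j e = ↑ˡ≢↑ʳ i j (suc-injective e)

isRight? : ∀ a m (v : Fin (a + m)) → Dec (∃ λ k → v ≡ a ↑ʳ k)
isRight? a m v with split a m v
... | left i  = no λ (k , e) → ↑ˡ≢↑ʳ i k e
... | right j = yes (j , refl)

rightVars : ∀ a m → Fin (a + m) → Bool
rightVars a m v = isYes (isRight? a m v)

rightVars-↑ʳ : ∀ a m k → T (rightVars a m (a ↑ʳ k))
rightVars-↑ʳ a m k = fromWitness {a? = isRight? a m (a ↑ʳ k)} (k , refl)

G′-cong : ∀ a m → Extensional (G′ a m)
G′-cong a m x≗y = H-cong (a + 1) (++-cong _ _ (x≗y ∘ (_↑ˡ m)) λ _ → H-cong m (x≗y ∘ (a ↑ʳ_)))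

G′-intro : ∀ a m (x : Fin (a + m) → Bool) {i j j′} → j ≢ j′ →
           T (x (i ↑ˡ m)) → T (x (a ↑ʳ j)) → T (x (a ↑ʳ j′)) → T (G′ a m x)
G′-intro a m x {i} j≢j′ xᵢ xⱼ xⱼ′ =
  H-intro (a + 1) (xˡ ++ λ _ → H m xʳ) {i ↑ˡ 1} {a ↑ʳ zero} (↑ˡ≢↑ʳ i zero)
    (subst T (sym (lookup-++ˡ xˡ _ i)) xᵢ)
    (subst T (sym (lookup-++ʳ xˡ (λ _ → H m xʳ) zero)) (H-intro m xʳ j≢j′ xⱼ xⱼ′))
  where
  xˡ : Fin a → Bool
  xˡ = x ∘ (_↑ˡ m)
  xʳ : Fin m → Bool
  xʳ = x ∘ (a ↑ʳ_)

G′-elim : ∀ a m (x : Fin (a + m) → Bool) → T (G′ a m x) →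
          T (H a (x ∘ (_↑ˡ m))) ⊎ ((∃ λ i → T (x (i ↑ˡ m))) × T (H m (x ∘ (a ↑ʳ_))))
G′-elim a m x g =
  let k , k′ , k≢k′ , yₖ , yₖ′ = H-elim (a + 1) y g in cases (split a 1 k) (split a 1 k′) k≢k′ yₖ yₖ′
  where
  y : Fin (a + 1) → Bool
  y = (x ∘ (_↑ˡ m)) ++ λ _ → H m (x ∘ (a ↑ʳ_))
  yˡ : ∀ i → T (y (i ↑ˡ 1)) → T (x (i ↑ˡ m))
  yˡ i = subst T (lookup-++ˡ (x ∘ (_↑ˡ m)) _ i)
  yʳ : T (y (a ↑ʳ zero)) → T (H m (x ∘ (a ↑ʳ_)))
  yʳ = subst T (lookup-++ʳ (x ∘ (_↑ˡ m)) (λ _ → H m (x ∘ (a ↑ʳ_))) zero)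
  cases : ∀ {k k′} → Split a 1 k → Split a 1 k′ → k ≢ k′ → T (y k) → T (y k′) →
          T (H a (x ∘ (_↑ˡ m))) ⊎ ((∃ λ i → T (x (i ↑ˡ m))) × T (H m (x ∘ (a ↑ʳ_))))
  cases (left i)     (left i′)    i≢i′ yᵢ yᵢ′ = inj₁ (H-intro a _ (i≢i′ ∘ cong (_↑ˡ 1)) (yˡ i yᵢ) (yˡ i′ yᵢ′))
  cases (left i)     (right zero) _    yᵢ h   = inj₂ ((i , yˡ i yᵢ) , yʳ h)
  cases (right zero) (left i)     _    h  yᵢ  = inj₂ ((i , yˡ i yᵢ) , yʳ h)
  cases (right zero) (right zero) ne   _  _   = contradiction refl ne

G′-left : ∀ a m (x : Fin (a + m) → Bool) → T (G′ a m x) → ∃ λ i → T (x (i ↑ˡ m))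
G′-left a m x g = [ someLeft , proj₁ ] (G′-elim a m x g)
  where
  someLeft : T (H a (x ∘ (_↑ˡ m))) → ∃ λ i → T (x (i ↑ˡ m))
  someLeft h = let i , _ , _ , xᵢ , _ = H-elim a (x ∘ (_↑ˡ m)) h in i , xᵢ

G′-rightVars : ∀ a m → ¬ T (G′ a m (rightVars a m))
G′-rightVars a m g = let i , rᵢ = G′-left a m (rightVars a m) g
                         k , i≡k = toWitness {a? = isRight? a m (i ↑ˡ m)} rᵢ
                     in ↑ˡ≢↑ʳ i k i≡k

G′-rightPair : ∀ a m (u : Fin (a + m)) k → ¬ T (G′ a m (⁅ u ⁆ ∪ ⁅ a ↑ʳ k ⁆))
G′-rightPair a m u k = [ leftFalse , rightFalse ] ∘ G′-elim a m x
  where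
  x : Fin (a + m) → Bool
  x = ⁅ u ⁆ ∪ ⁅ a ↑ʳ k ⁆
  onLeft : ∀ i → T (x (i ↑ˡ m)) → i ↑ˡ m ≡ u
  onLeft i xᵢ with ∪-elim ⁅ u ⁆ ⁅ a ↑ʳ k ⁆ (i ↑ˡ m) xᵢ
  ... | inj₁ i≡u = ⁅⁆-elim i≡u
  ... | inj₂ i≡k = contradiction (⁅⁆-elim i≡k) (↑ˡ≢↑ʳ i k)
  leftFalse : ¬ T (H a (x ∘ (_↑ˡ m)))
  leftFalse = H-atMostOne a _ λ {i} {i′} xᵢ xᵢ′ →
    ↑ˡ-injective m i i′ (trans (onLeft i xᵢ) (sym (onLeft i′ xᵢ′)))
  rightFalse : ¬ ((∃ λ i → T (x (i ↑ˡ m))) × T (H m (x ∘ (a ↑ʳ_))))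
  rightFalse ((i , xᵢ) , h) = H-atMostOne m _ (λ {j} {j′} xⱼ xⱼ′ → trans (onRight j xⱼ) (sym (onRight j′ xⱼ′))) h
    where
    onRight : ∀ j → T (x (a ↑ʳ j)) → j ≡ k
    onRight j xⱼ with ∪-elim ⁅ u ⁆ ⁅ a ↑ʳ k ⁆ (a ↑ʳ j) xⱼ
    ... | inj₁ j≡u = contradiction (trans (onLeft i xᵢ) (sym (⁅⁆-elim j≡u))) (↑ˡ≢↑ʳ i j)
    ... | inj₂ j≡k = ↑ʳ-injective a j k (⁅⁆-elim j≡k)

G′-rightVars-∪-left : ∀ a {m} → 2 ≤ m → ∀ i → T (G′ a m (rightVars a m ∪ ⁅ i ↑ˡ m ⁆))
G′-rightVars-∪-left a {m} 2≤m i =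
  G′-intro a m (r ∪ ⁅ i ↑ˡ m ⁆) q≢q′
    (∪-introʳ r ⁅ i ↑ˡ m ⁆ (i ↑ˡ m) (⁅⁆-self (i ↑ˡ m)))
    (∪-introˡ r ⁅ i ↑ˡ m ⁆ (a ↑ʳ q) (rightVars-↑ʳ a m q))
    (∪-introˡ r ⁅ i ↑ˡ m ⁆ (a ↑ʳ q′) (rightVars-↑ʳ a m q′))
  where
  r : Fin (a + m) → Bool
  r = rightVars a m
  q q′ : Fin m
  q = proj₁ (twoPoints 2≤m)
  q′ = proj₁ (proj₂ (twoPoints 2≤m))
  q≢q′ : q ≢ q′
  q≢q′ = proj₂ (proj₂ (twoPoints 2≤m))

G′-essential : ∀ {a m} → Fin a → 2 ≤ m → ∀ v → Essential (G′ a m) v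
G′-essential {a} {m} i₀ 2≤m v with split a m v
... | left i = rightVars a m , G′-rightVars a m , G′-rightVars-∪-left a 2≤m i
... | right j = x , G′-rightPair a m u j′ ,
  G′-intro a m (x ∪ ⁅ a ↑ʳ j ⁆) {i₀} {j′} {j} j′≢j
    (∪-introˡ x ⁅ a ↑ʳ j ⁆ u (∪-introˡ ⁅ u ⁆ ⁅ a ↑ʳ j′ ⁆ u (⁅⁆-self u)))
    (∪-introˡ x ⁅ a ↑ʳ j ⁆ (a ↑ʳ j′) (∪-introʳ ⁅ u ⁆ ⁅ a ↑ʳ j′ ⁆ (a ↑ʳ j′) (⁅⁆-self (a ↑ʳ j′))))
    (∪-introʳ x ⁅ a ↑ʳ j ⁆ (a ↑ʳ j) (⁅⁆-self (a ↑ʳ j)))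
  where
  u : Fin (a + m)
  u = i₀ ↑ˡ m
  j′ : Fin m
  j′ = proj₁ (another 2≤m j)
  j′≢j : j′ ≢ j
  j′≢j = proj₂ (another 2≤m j)
  x : Fin (a + m) → Bool
  x = ⁅ u ⁆ ∪ ⁅ a ↑ʳ j′ ⁆

FalseAbove : ∀ a m (w v v′ : Fin (a + m)) → Set
FalseAbove a m w v v′ = ∃ λ x → ¬ T (G′ a m x) × T (x w) × T (x v) × T (x v′)

rightPair-falseAbove : ∀ a m (u : Fin (a + m)) k {w v v′} →
  w ≡ u ⊎ w ≡ a ↑ʳ k → v ≡ u ⊎ v ≡ a ↑ʳ k → v′ ≡ u ⊎ v′ ≡ a ↑ʳ k → FalseAbove a m w v v′
rightPair-falseAbove a m u k w∈ v∈ v′∈ = x , G′-rightPair a m u k , ∈x w∈ , ∈x v∈ , ∈x v′∈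
  where
  x : Fin (a + m) → Bool
  x = ⁅ u ⁆ ∪ ⁅ a ↑ʳ k ⁆
  ∈x : ∀ {t} → t ≡ u ⊎ t ≡ a ↑ʳ k → T (x t)
  ∈x (inj₁ refl) = ∪-introˡ ⁅ u ⁆ ⁅ a ↑ʳ k ⁆ u (⁅⁆-self u)
  ∈x (inj₂ refl) = ∪-introʳ ⁅ u ⁆ ⁅ a ↑ʳ k ⁆ (a ↑ʳ k) (⁅⁆-self (a ↑ʳ k))

collapse : ∀ {a m v} → Split a m v → Fin (suc a)
collapse (left i)  = suc i
collapse (right _) = zero

collapse-falseAbove : ∀ {a m v v′} k (s : Split a m v) (s′ : Split a m v′) →
                      collapse s ≡ collapse s′ → FalseAbove a m (a ↑ʳ k) v v′
collapse-falseAbove {a} {m} k (left i) (left i′) same with suc-injective same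
... | refl = rightPair-falseAbove a m (i ↑ˡ m) k (inj₂ refl) (inj₁ refl) (inj₁ refl)
collapse-falseAbove {a} {m} k (right j) (right j′) _ =
  rightVars a m , G′-rightVars a m , rightVars-↑ʳ a m k , rightVars-↑ʳ a m j , rightVars-↑ʳ a m j′

fold : ∀ {a m v} → a ≤ m → Split a m v → Fin m
fold a≤m (left i)  = inject≤ i a≤m
fold a≤m (right j) = j

fold-falseAbove : ∀ {a m v v′} (i₀ : Fin a) (a≤m : a ≤ m) (s : Split a m v) (s′ : Split a m v′) →
                  fold a≤m s ≡ fold a≤m s′ → ∃ λ i → FalseAbove a m (i ↑ˡ m) v v′
fold-falseAbove {a} {m} _ a≤m (left i) (left i′) same with inject≤-injective a≤m a≤m i i′ same
... | refl = i , rightPair-falseAbove a m (i ↑ˡ m) (inject≤ i a≤m) (inj₁ refl) (inj₁ refl) (inj₁ refl)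
fold-falseAbove {a} {m} _ _ (left i) (right j) _ =
  i , rightPair-falseAbove a m (i ↑ˡ m) j (inj₁ refl) (inj₁ refl) (inj₂ refl)
fold-falseAbove {a} {m} _ _ (right j) (left i) _ =
  i , rightPair-falseAbove a m (i ↑ˡ m) j (inj₁ refl) (inj₂ refl) (inj₁ refl)
fold-falseAbove {a} {m} i₀ _ (right j) (right .j) refl =
  i₀ , rightPair-falseAbove a m (i₀ ↑ˡ m) j (inj₁ refl) (inj₂ refl) (inj₂ refl)

module G′-minor {a m m′ : ℕ} (1≤a : 1 ≤ a) (a<m : a < m) (G≤G′ : G′ a m ⪯V G′ a m′) where

  i₀ : Fin a
  i₀ = fromℕ< 1≤a

  2≤m : 2 ≤ m
  2≤m = ≤-<-trans 1≤a a<m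

  σ : Fin (a + m′) → Fin (a + m)
  σ = proj₁ G≤G′

  splitσ : ∀ j → Split a m (σ (a ↑ʳ j))
  splitσ j = split a m (σ (a ↑ʳ j))

  refute : ∀ {p w j j′} → σ (p ↑ˡ m′) ≡ w → j ≢ j′ → ¬ FalseAbove a m w (σ (a ↑ʳ j)) (σ (a ↑ʳ j′))
  refute refl j≢j′ (x , ¬Gx , x₀ , x₁ , x₂) =
    ¬Gx (⪯V-reflects-T {g = G′ a m} {f = G′ a m′} G≤G′ x (G′-intro a m′ (x ∘ σ) j≢j′ x₀ x₁ x₂))

  m≤m′ : m ≤ m′
  m≤m′ = +-cancelˡ-≤ a m m′ (essential⇒≤ (G′-cong a m′) G≤G′ (G′-essential i₀ 2≤m))

  someLeftToRight : ∀ {p k} → σ (p ↑ˡ m′) ≡ a ↑ʳ k → ¬ m < m′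
  someLeftToRight {k = k} σp≡k m<m′ =
    let j , j′ , j<j′ , same = pigeonhole (≤-<-trans a<m m<m′) (collapse ∘ splitσ)
    in refute σp≡k (<⇒≢ j<j′) (collapse-falseAbove k (splitσ j) (splitσ j′) same)

  leftsOnto : (∀ p → ¬ ∃ λ k → σ (p ↑ˡ m′) ≡ a ↑ʳ k) → ∀ i → ∃ λ p → σ (p ↑ˡ m′) ≡ i ↑ˡ m
  leftsOnto noneRight i = p , [ leftIsNotRight , ⁅⁆-elim ]′ (∪-elim r ⁅ i ↑ˡ m ⁆ (σ (p ↑ˡ m′)) xₚ)
    where
    r : Fin (a + m) → Bool
    r = rightVars a m
    x : Fin (a + m) → Bool
    x = r ∪ ⁅ i ↑ˡ m ⁆
    hit : ∃ λ p → T (x (σ (p ↑ˡ m′)))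
    hit = G′-left a m′ (x ∘ σ) (subst T (proj₂ G≤G′ x) (G′-rightVars-∪-left a 2≤m i))
    p : Fin a
    p = proj₁ hit
    xₚ : T (x (σ (p ↑ˡ m′)))
    xₚ = proj₂ hit
    leftIsNotRight : T (r (σ (p ↑ˡ m′))) → σ (p ↑ˡ m′) ≡ i ↑ˡ m
    leftIsNotRight isRight = contradiction (toWitness {a? = isRight? a m (σ (p ↑ˡ m′))} isRight) (noneRight p)

  noLeftToRight : (∀ p → ¬ ∃ λ k → σ (p ↑ˡ m′) ≡ a ↑ʳ k) → ¬ m < m′
  noLeftToRight noneRight m<m′ =
    let j , j′ , j<j′ , same = pigeonhole m<m′ (fold (<⇒≤ a<m) ∘ splitσ)
        i , above = fold-falseAbove i₀ (<⇒≤ a<m) (splitσ j) (splitσ j′) same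
        p , σp≡i = leftsOnto noneRight i
    in refute σp≡i (<⇒≢ j<j′) above

  m′≤m : m′ ≤ m
  m′≤m = ≮⇒≥ λ m<m′ → case (any? (λ p → isRight? a m (σ (p ↑ˡ m′)))) m<m′
    where
    case : Dec (∃ λ p → ∃ λ k → σ (p ↑ˡ m′) ≡ a ↑ʳ k) → ¬ m < m′
    case (yes (_ , _ , σp≡k)) = someLeftToRight σp≡k
    case (no none)            = noLeftToRight λ p r → none (p , r)

G-⪯V⇒≡ : ∀ {n m m′} → 2 ≤ n → n ≤ m → G n m ⪯V G n m′ → m ≡ m′
G-⪯V⇒≡ {suc (suc _)} (s≤s 1≤a) a<m G≤G′ = ≤-antisym m≤m′ m′≤m
  where open G′-minor 1≤a a<m G≤G′

lemma5 : ((n n′ : ℕ) → 2 ≤ n → 2 ≤ n′ → n ≢ n′ → ¬ (H n ⪯V H n′))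
         × ((n : ℕ) → 2 ≤ n → (m m′ : ℕ) → n ≤ m → n ≤ m′ → m ≢ m′ → ¬ (G n m ⪯V G n m′))
lemma5 = (λ _ _ 2≤n _ n≢n′ H≤H′ → n≢n′ (H-⪯V⇒≡ 2≤n H≤H′))
       , (λ _ 2≤n _ _ n≤m _ m≢m′ G≤G′ → m≢m′ (G-⪯V⇒≡ 2≤n n≤m G≤G′))
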